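{- Let $G$ be an abelian group (written additively with $\oplus$, identity $\mathcal O$), and let $N$ be an odd positive integer such that there is a group isomorphism $\psi:(\mathbb Z/N\mathbb Z)\times(\mathbb Z/N\mathbb Z)\to G[N]$. For $1\le k\le N^2$ write $k-1 = m+Nn$ with $0\le m,n<N$ and set $R_k=\psi((m,n))$, so $G[N]=\{R_1,\dots,R_{N^2}\}$. Fix integers $a,b,c,d$, each relatively prime to $N$, such that $ad-bc$ is also relatively prime to $N$, fix integers $x_1,y_1$, and define for $1\le k\le N^2$ \[ x_k \equiv x_1 + a(k-1) + b\left\lfloor \tfrac{k-1}{N}\right\rfloor \pmod N,\qquad y_k \equiv y_1 + c(k-1) + d\left\lfloor \tfrac{k-1}{N}\right\rfloor \pmod N. \] Then placing $R_k$ in position $(x_k,y_k)$ of an $N\times N$ grid (positions indexed by pairs of residues mod $N$) puts exactly one element of $G[N]$ in each cell, and the sum of the entries of each column and of each row is the identity $\mathcal O$.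
   Context: $G[N]=\{P\in G: [N]P=\mathcal O\}$, where $[N]P$ is $P$ added to itself $N$ times. $\lfloor\cdot\rfloor$ is the greatest integer function. -}

module Defs where

open import Level using (Level)
open import Algebra.Bundles using (AbelianGroup)
open import Data.Nat using (ℕ; _≟_; zero; suc; NonZero; _<_) renaming (_+_ to _+ℕ_; _*_ to _*ℕ_)
open import Data.Nat.DivMod using (_mod_; _/_)
open import Data.Fin using (Fin; toℕ)
open import Data.Integer using (ℤ; +_) renaming (_+_ to _+ℤ_; _*_ to _*ℤ_)
open import Data.Integer.DivMod using (_%ℕ_)
open import Data.Product using (_×_; _,_; Σ; ∃)
open import Data.List using (List; foldr; filter; map; upTo)
open import Relation.Binary.PropositionalEquality using (_≡_)
import Data.Nat.Properties as ℕP

-- ℤ/Nℤ is modelled as Fin N with addition modulo N.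
addMod : (N : ℕ) → .{{NonZero N}} → Fin N → Fin N → Fin N
addMod N u v = (toℕ u +ℕ toℕ v) mod N

addPair : (N : ℕ) → .{{NonZero N}} → Fin N × Fin N → Fin N × Fin N → Fin N × Fin N
addPair N (u₁ , v₁) (u₂ , v₂) = (addMod N u₁ u₂ , addMod N v₁ v₂)

module _ {c ℓ : Level} (G : AbelianGroup c ℓ) where
  open AbelianGroup G renaming (Carrier to A)

  mulℕ : ℕ → A → A
  mulℕ zero    P = ε
  mulℕ (suc n) P = P ∙ mulℕ n P

  InTorsion : ℕ → A → Set ℓ
  InTorsion N P = mulℕ N P ≈ ε

  record IsTorsionIso (N : ℕ) .{{_ : NonZero N}} (ψ : Fin N × Fin N → A) : Set (c Level.⊔ ℓ) where
    field
      into    : ∀ u → InTorsion N (ψ u)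
      hom     : ∀ u v → ψ (addPair N u v) ≈ ψ u ∙ ψ v
      inj     : ∀ u v → ψ u ≈ ψ v → u ≡ v
      onto    : ∀ P → InTorsion N P → Σ (Fin N × Fin N) (λ u → ψ u ≈ P)

  sumG : List A → A
  sumG = foldr _∙_ ε

-- R_k with k - 1 = i = m + N n, m = i mod N, n = ⌊ i / N ⌋
-- (for i < N², ⌊ i / N ⌋ < N, so reducing it mod N does not change it)
Ridx : (N : ℕ) → .{{NonZero N}} → ℕ → Fin N × Fin N
Ridx N i = (i mod N , (i / N) mod N)

-- x_k (and, with (c,d,y₁), y_k) for i = k - 1, as a residue in {0,…,N-1}
coord : (N : ℕ) → .{{NonZero N}} → (z₁ p q : ℤ) → ℕ → ℕ
coord N z₁ p q i = (z₁ +ℤ p *ℤ (+ i) +ℤ q *ℤ (+ (i / N))) %ℕ N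

-- the entries R_i (i = k - 1 < N²) placed in column x (cells with x-coordinate x)
-- resp. row y (cells with y-coordinate y), listed by increasing i
cellsWith : (N : ℕ) → .{{NonZero N}} → (z₁ p q : ℤ) → ℕ → List ℕ
cellsWith N z₁ p q x = filter (λ i → coord N z₁ p q i ≟ x) (upTo (N *ℕ N))

module Submission where

-- Write the index i = k - 1 of R_k as i = n·N + m with m, n < N, so that R_k = ψ(m, n) and
-- the two coordinates are the affine forms x₁ + a·m + b·n and y₁ + c·m + d·n modulo N.
--
-- * Latin-square property: the cell (x, y) is hit by the cells (m, n) solving a 2×2
--   linear system modulo N whose determinant ad - bc is a unit, so by Cramer's rule it
--   has exactly one solution with m, n < N.
-- * Zero sums: in column x and block n, the equation x₁ + a·m + b·n ≡ x has exactly one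
--   solution m = m₀(n) because a is a unit, and m₀ is an affine function of n modulo N.
--   Hence the column sum is ψ(Σ m₀(n), Σ n), and the sum of an affine function over a
--   full period 0, …, N - 1 vanishes modulo N because N is odd (Σ n = N·(N - 1)/2).
--   Rows are the same statement for (y₁, c, d).

open import Defs
open import Level using (Level; 0ℓ)
open import Algebra.Bundles using (AbelianGroup; Monoid)
open import Data.Nat using (ℕ; NonZero; zero; suc; s≤s; z<s; _<_; _≟_)
  renaming (_+_ to _+ℕ_; _*_ to _*ℕ_)
import Data.Nat.Properties as ℕP
open import Data.Nat.DivMod using (_%_; _/_; _mod_)
import Data.Nat.DivMod as ℕD
open import Data.Nat.Coprimality using (Coprime; coprime-Bézout)
open import Data.Nat.GCD using (module Bézout)
open import Data.Nat.Divisibility using (_∣_; m%n≡0⇒n∣m; n∣m*n)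
open import Data.Fin using (Fin)
import Data.Fin.Properties as FinP
open import Data.Integer using (ℤ; +_; -[1+_]; ∣_∣; _+_; _-_; -_; _*_)
import Data.Integer.Properties as ℤP
open import Data.Integer.DivMod using (_%ℕ_; _/ℕ_; a≡a%ℕn+[a/ℕn]*n; n%ℕd<d)
open import Data.Integer.Tactic.RingSolver using (solve-∀)
import Data.Nat.Tactic.RingSolver as ℕSolver
open import Data.Product using (_×_; _,_; Σ; proj₁; proj₂)
open import Data.List using ([]; _∷_; map; filter; applyUpTo; upTo)
open import Function using (id; _∘_)
open import Relation.Nullary using (¬_; Dec; yes; no; contradiction)
open import Relation.Unary using (Pred; Decidable)
open import Relation.Binary.Bundles using (Setoid)
open import Relation.Binary.PropositionalEquality
  using (_≡_; _≢_; refl; sym; trans; cong; cong₂; subst; module ≡-Reasoning)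

module IndexedSum {a ℓ} (M : Monoid a ℓ) where
  open Monoid M
    renaming (refl to ≈-refl; sym to ≈-sym; trans to ≈-trans; reflexive to ≈-reflexive)
  open import Relation.Binary.Reasoning.Setoid setoid

  sumTo : ℕ → (ℕ → Carrier) → Carrier
  sumTo zero    f = ε
  sumTo (suc n) f = f 0 ∙ sumTo n (f ∘ suc)

  sumTo-cong : ∀ n {f g : ℕ → Carrier} → (∀ i → i < n → f i ≈ g i) → sumTo n f ≈ sumTo n g
  sumTo-cong zero    f≈g = ≈-refl
  sumTo-cong (suc n) f≈g = ∙-cong (f≈g 0 z<s) (sumTo-cong n (λ i i<n → f≈g (suc i) (s≤s i<n)))

  sumTo-snoc : ∀ n f → sumTo (suc n) f ≈ sumTo n f ∙ f n
  sumTo-snoc zero    f = ≈-trans (identityʳ (f 0)) (≈-sym (identityˡ (f 0)))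
  sumTo-snoc (suc n) f = ≈-trans (∙-congˡ (sumTo-snoc n (f ∘ suc))) (≈-sym (assoc _ _ _))

  sumTo-+ : ∀ m n f → sumTo (m +ℕ n) f ≈ sumTo m f ∙ sumTo n (λ i → f (m +ℕ i))
  sumTo-+ zero    n f = ≈-sym (identityˡ _)
  sumTo-+ (suc m) n f = ≈-trans (∙-congˡ (sumTo-+ m n (f ∘ suc))) (≈-sym (assoc _ _ _))

  sumTo-blocks : ∀ k N f → sumTo (k *ℕ N) f ≈ sumTo k (λ n → sumTo N (λ m → f (n *ℕ N +ℕ m)))
  sumTo-blocks zero    N f = ≈-refl
  sumTo-blocks (suc k) N f = begin
    sumTo (N +ℕ k *ℕ N) f
      ≈⟨ sumTo-+ N (k *ℕ N) f ⟩
    sumTo N f ∙ sumTo (k *ℕ N) (λ i → f (N +ℕ i))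
      ≈⟨ ∙-congˡ (sumTo-blocks k N (λ i → f (N +ℕ i))) ⟩
    sumTo N f ∙ sumTo k (λ n → sumTo N (λ m → f (N +ℕ (n *ℕ N +ℕ m))))
      ≈⟨ ∙-congˡ (sumTo-cong k (λ n _ → sumTo-cong N (λ m _ →
           ≈-reflexive (cong f (sym (ℕP.+-assoc N (n *ℕ N) m)))))) ⟩
    sumTo (suc k) (λ n → sumTo N (λ m → f (n *ℕ N +ℕ m))) ∎

  sumTo-ε : ∀ n {f} → (∀ i → i < n → f i ≈ ε) → sumTo n f ≈ ε
  sumTo-ε zero    f≈ε = ≈-refl
  sumTo-ε (suc n) f≈ε =
    ≈-trans (∙-cong (f≈ε 0 z<s) (sumTo-ε n (λ i i<n → f≈ε (suc i) (s≤s i<n)))) (identityˡ ε)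

  sumTo-single : ∀ n f j → j < n → (∀ i → i < n → i ≢ j → f i ≈ ε) → sumTo n f ≈ f j
  sumTo-single (suc n) f zero    _         others =
    ≈-trans (∙-congˡ (sumTo-ε n (λ i i<n → others (suc i) (s≤s i<n) (λ ())))) (identityʳ (f 0))
  sumTo-single (suc n) f (suc j) (s≤s j<n) others =
    ≈-trans (∙-congʳ (others 0 z<s (λ ())))
      (≈-trans (identityˡ _) (sumTo-single n (f ∘ suc) j j<n
        (λ i i<n i≢j → others (suc i) (s≤s i<n) (i≢j ∘ ℕP.suc-injective))))

open IndexedSum ℕP.+-0-monoid using () renaming (sumTo to sumℕ; sumTo-snoc to sumℕ-snoc)

odd-form : ∀ n → ¬ (2 ∣ n) → n ≡ suc (n / 2 *ℕ 2)
odd-form n ¬2∣n with n % 2 | ℕD.m%n<n n 2 | ℕD.m≡m%n+[m/n]*n n 2 | m%n≡0⇒n∣m n 2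
... | 0           | _             | _     | 2∣n = contradiction (2∣n refl) ¬2∣n
... | 1           | _             | n≡1+q | _   = n≡1+q
... | suc (suc _) | s≤s (s≤s ()) | _     | _

gauss-odd : ∀ k → sumℕ (suc (k *ℕ 2)) id ≡ k *ℕ suc (k *ℕ 2)
gauss-odd zero    = refl
gauss-odd (suc k) = begin
  sumℕ (suc (suc (suc (k *ℕ 2)))) id
    ≡⟨ sumℕ-snoc (suc (suc (k *ℕ 2))) id ⟩
  sumℕ (suc (suc (k *ℕ 2))) id +ℕ suc (suc (k *ℕ 2))
    ≡⟨ cong (_+ℕ suc (suc (k *ℕ 2))) (sumℕ-snoc (suc (k *ℕ 2)) id) ⟩
  sumℕ (suc (k *ℕ 2)) id +ℕ suc (k *ℕ 2) +ℕ suc (suc (k *ℕ 2))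
    ≡⟨ cong (λ s → s +ℕ suc (k *ℕ 2) +ℕ suc (suc (k *ℕ 2))) (gauss-odd k) ⟩
  k *ℕ suc (k *ℕ 2) +ℕ suc (k *ℕ 2) +ℕ suc (suc (k *ℕ 2))
    ≡⟨ gauss-step k ⟩
  suc k *ℕ suc (suc k *ℕ 2) ∎
  where
  open ≡-Reasoning
  gauss-step : ∀ k → k *ℕ suc (k *ℕ 2) +ℕ suc (k *ℕ 2) +ℕ suc (suc (k *ℕ 2))
    ≡ suc k *ℕ suc (suc k *ℕ 2)
  gauss-step = ℕSolver.solve-∀

odd-sum-multiple : ∀ N → ¬ (2 ∣ N) → Σ ℕ (λ k → sumℕ N id ≡ k *ℕ N)
odd-sum-multiple N ¬2∣N =
  N / 2 , subst (λ s → sumℕ s id ≡ N / 2 *ℕ s) (sym (odd-form N ¬2∣N)) (gauss-odd (N / 2))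

lin : (z p q m n : ℤ) → ℤ
lin z p q m n = z + p * m + q * n

module Congruence (N : ℕ) .{{_ : NonZero N}} where

  infix 4 _≋_
  record _≋_ (a b : ℤ) : Set where
    constructor by
    field
      quotient : ℤ
      equation : a ≡ b + quotient * + N

  ≋-refl : ∀ {a} → a ≋ a
  ≋-refl {a} = by (+ 0) (add-zero a (+ N))
    where
    add-zero : ∀ a n → a ≡ a + + 0 * n
    add-zero = solve-∀

  ≋-reflexive : ∀ {a b} → a ≡ b → a ≋ b
  ≋-reflexive refl = ≋-refl

  ≋-sym : ∀ {a b} → a ≋ b → b ≋ a
  ≋-sym {b = b} (by k a≡b+kN) =
    by (- k) (trans (cancel-out b k (+ N)) (cong (λ v → v + - k * + N) (sym a≡b+kN)))
    where
    cancel-out : ∀ b k n → b ≡ b + k * n + - k * n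
    cancel-out = solve-∀

  ≋-trans : ∀ {a b c} → a ≋ b → b ≋ c → a ≋ c
  ≋-trans {c = c} (by k refl) (by l refl) = by (l + k) (collect c l k (+ N))
    where
    collect : ∀ c l k n → c + l * n + k * n ≡ c + (l + k) * n
    collect = solve-∀

  ≋-setoid : Setoid 0ℓ 0ℓ
  ≋-setoid = record
    { Carrier = ℤ ; _≈_ = _≋_
    ; isEquivalence = record { refl = ≋-refl ; sym = ≋-sym ; trans = ≋-trans } }

  open import Relation.Binary.Reasoning.Setoid ≋-setoid

  +-cong : ∀ {a a′ b b′} → a ≋ a′ → b ≋ b′ → a + b ≋ a′ + b′
  +-cong {a′ = a′} {b′ = b′} (by k refl) (by l refl) = by (k + l) (collect a′ k b′ l (+ N))
    where
    collect : ∀ a k b l n → a + k * n + (b + l * n) ≡ a + b + (k + l) * n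
    collect = solve-∀

  *-cong : ∀ {a a′ b b′} → a ≋ a′ → b ≋ b′ → a * b ≋ a′ * b′
  *-cong {a′ = a′} {b′ = b′} (by k refl) (by l refl) =
    by (a′ * l + k * b′ + k * l * + N) (expand a′ k b′ l (+ N))
    where
    expand : ∀ a k b l n → (a + k * n) * (b + l * n) ≡ a * b + (a * l + k * b + k * l * n) * n
    expand = solve-∀

  neg-cong : ∀ {a a′} → a ≋ a′ → - a ≋ - a′
  neg-cong {a′ = a′} (by k refl) = by (- k) (negate a′ k (+ N))
    where
    negate : ∀ a k n → - (a + k * n) ≡ - a + - k * n
    negate = solve-∀

  -- one-sided versions, with the fixed operand explicit (it cannot be inferred through _*_)
  +-congˡ : ∀ a {b b′} → b ≋ b′ → a + b ≋ a + b′
  +-congˡ a = +-cong (≋-refl {a})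

  +-congʳ : ∀ {a a′} b → a ≋ a′ → a + b ≋ a′ + b
  +-congʳ b a≋a′ = +-cong a≋a′ (≋-refl {b})

  *-congˡ : ∀ a {b b′} → b ≋ b′ → a * b ≋ a * b′
  *-congˡ a = *-cong (≋-refl {a})

  *-congʳ : ∀ {a a′} b → a ≋ a′ → a * b ≋ a′ * b
  *-congʳ b a≋a′ = *-cong a≋a′ (≋-refl {b})

  lin-cong : ∀ {z p q m m′ n n′} → m ≋ m′ → n ≋ n′ → lin z p q m n ≋ lin z p q m′ n′
  lin-cong {z} {p} {q} m≋m′ n≋n′ = +-cong (+-congˡ z (*-congˡ p m≋m′)) (*-congˡ q n≋n′)

  multiple≋0 : ∀ k → k * + N ≋ + 0
  multiple≋0 k = by k (sym (ℤP.+-identityˡ (k * + N)))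

  pos-split : ∀ s t → + (s +ℕ t *ℕ N) ≡ + s + + t * + N
  pos-split s t = trans (ℤP.pos-+ s (t *ℕ N)) (cong (λ v → + s + v) (ℤP.pos-* t N))

  ℕ-≋ : ∀ {r s} t → r ≡ s +ℕ t *ℕ N → + r ≋ + s
  ℕ-≋ {s = s} t refl = by (+ t) (pos-split s t)

  %ℕ-≋ : ∀ a → + (a %ℕ N) ≋ a
  %ℕ-≋ a = ≋-sym (by (a /ℕ N) (a≡a%ℕn+[a/ℕn]*n a N))

  -- r = s + t·N with r, s < N forces r = s, since both are then the remainder of r by N
  residue-above : ∀ {r s} → r < N → s < N → ∀ t → + r ≡ + s + + t * + N → r ≡ s
  residue-above {r} {s} r<N s<N t eq =
    trans (sym (ℕD.m<n⇒m%n≡m r<N))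
      (trans (ℕD.%-congˡ r≡s+tN) (trans (ℕD.[m+kn]%n≡m%n s t N) (ℕD.m<n⇒m%n≡m s<N)))
    where
    r≡s+tN : r ≡ s +ℕ t *ℕ N
    r≡s+tN = ℤP.+-injective (trans eq (sym (pos-split s t)))

  residue-unique : ∀ {r s} → r < N → s < N → + r ≋ + s → r ≡ s
  residue-unique r<N s<N (by (+ t) eq)       = residue-above r<N s<N t eq
  residue-unique r<N s<N e@(by -[1+ t ] _) =
    sym (residue-above s<N r<N (suc t) (_≋_.equation (≋-sym e)))

  %ℕ-cong : ∀ {a b} → a ≋ b → a %ℕ N ≡ b %ℕ N
  %ℕ-cong {a} {b} a≋b = residue-unique (n%ℕd<d a N) (n%ℕd<d b N)
    (≋-trans (%ℕ-≋ a) (≋-trans a≋b (≋-sym (%ℕ-≋ b))))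

  inverseℕ : ∀ m → Coprime m N → Σ ℤ (λ u → u * + m ≋ + 1)
  inverseℕ m cop with coprime-Bézout cop
  ... | Bézout.+- x y 1+yN≡xm = + x , ≋-trans (≋-reflexive (sym (ℤP.pos-* x m))) (ℕ-≋ y (sym 1+yN≡xm))
  ... | Bézout.-+ x y 1+xm≡yN = - + x , (begin
    - + x * + m               ≡⟨ negate (+ x) (+ m) ⟩
    + 1 - (+ 1 + + x * + m)   ≡⟨ cong (λ t → + 1 - (+ 1 + t)) (ℤP.pos-* x m) ⟨
    + 1 - (+ 1 + + (x *ℕ m))  ≡⟨ cong (λ t → + 1 - t) (ℤP.pos-+ 1 (x *ℕ m)) ⟨
    + 1 - + (1 +ℕ x *ℕ m)     ≈⟨ +-congˡ (+ 1) (neg-cong (ℕ-≋ y 1+xm≡yN)) ⟩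
    + 1 - + 0                 ≡⟨⟩
    + 1                       ∎)
    where
    negate : ∀ x m → - x * m ≡ + 1 - (+ 1 + x * m)
    negate = solve-∀

  inverse : ∀ a → Coprime ∣ a ∣ N → Σ ℤ (λ u → u * a ≋ + 1)
  inverse (+ m)    cop = inverseℕ m cop
  inverse -[1+ m ] cop with inverseℕ (suc m) cop
  ... | u , u*m≋1 = - u , ≋-trans (≋-reflexive (neg-*-neg u (+ suc m))) u*m≋1
    where
    neg-*-neg : ∀ u v → - u * - v ≡ u * v
    neg-*-neg = solve-∀

  cancel : ∀ {a x y} → Coprime ∣ a ∣ N → a * x ≋ a * y → x ≋ y
  cancel {a} {x} {y} cop ax≋ay with inverse a cop
  ... | u , ua≋1 = begin
    x            ≈⟨ undo x ⟨
    u * (a * x)  ≈⟨ *-congˡ u ax≋ay ⟩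
    u * (a * y)  ≈⟨ undo y ⟩
    y            ∎
    where
    undo : ∀ z → u * (a * z) ≋ z
    undo z = begin
      u * (a * z)  ≡⟨ ℤP.*-assoc u a z ⟨
      u * a * z    ≈⟨ *-congʳ z ua≋1 ⟩
      + 1 * z      ≡⟨ ℤP.*-identityˡ z ⟩
      z            ∎

  lin-injective : ∀ {z p q m m′ n} → Coprime ∣ p ∣ N → lin z p q m n ≋ lin z p q m′ n → m ≋ m′
  lin-injective {z} {p} {q} {m} {m′} {n} cop e = cancel {p} cop (begin
    p * m                             ≡⟨ isolate z p q m n ⟩
    lin z p q m n - (z + q * n)       ≈⟨ +-congʳ (- (z + q * n)) e ⟩
    lin z p q m′ n - (z + q * n)      ≡⟨ isolate z p q m′ n ⟨
    p * m′                            ∎)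
    where
    isolate : ∀ z p q m n → p * m ≡ z + p * m + q * n - (z + q * n)
    isolate = solve-∀

  cramer : ∀ {a b c d} → Coprime ∣ a * d - b * c ∣ N → ∀ z₁ z₂ X Y
    → Σ ℤ (λ m → Σ ℤ (λ n → lin z₁ a b m n ≋ X × lin z₂ c d m n ≋ Y))
  cramer {a} {b} {c} {d} cop z₁ z₂ X Y with inverse (a * d - b * c) cop
  ... | u , uD≋1 = m , n , solves-first , solves-second
    where
    X′ Y′ m n : ℤ
    X′ = X - z₁
    Y′ = Y - z₂
    m = u * (d * X′ - b * Y′)
    n = u * (a * Y′ - c * X′)
    first : ∀ z a b c d u X Y
      → z + a * (u * (d * X - b * Y)) + b * (u * (a * Y - c * X)) ≡ z + u * (a * d - b * c) * X
    first = solve-∀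
    second : ∀ z a b c d u X Y
      → z + c * (u * (d * X - b * Y)) + d * (u * (a * Y - c * X)) ≡ z + u * (a * d - b * c) * Y
    second = solve-∀
    shift-back : ∀ z X → z + + 1 * (X - z) ≡ X
    shift-back = solve-∀
    solves-first : lin z₁ a b m n ≋ X
    solves-first = begin
      lin z₁ a b m n                 ≡⟨ first z₁ a b c d u X′ Y′ ⟩
      z₁ + u * (a * d - b * c) * X′  ≈⟨ +-congˡ z₁ (*-congʳ X′ uD≋1) ⟩
      z₁ + + 1 * X′                  ≡⟨ shift-back z₁ X ⟩
      X                              ∎
    solves-second : lin z₂ c d m n ≋ Y
    solves-second = begin
      lin z₂ c d m n                 ≡⟨ second z₂ a b c d u X′ Y′ ⟩
      z₂ + u * (a * d - b * c) * Y′  ≈⟨ +-congˡ z₂ (*-congʳ Y′ uD≋1) ⟩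
      z₂ + + 1 * Y′                  ≡⟨ shift-back z₂ Y ⟩
      Y                              ∎

  cramer-unique : ∀ {a b c d z₁ z₂ m n m′ n′} → Coprime ∣ a * d - b * c ∣ N
    → lin z₁ a b m n ≋ lin z₁ a b m′ n′ → lin z₂ c d m n ≋ lin z₂ c d m′ n′ → m ≋ m′ × n ≋ n′
  cramer-unique {a} {b} {c} {d} {z₁} {z₂} {m} {n} {m′} {n′} cop e₁ e₂ =
    cancel {D} cop (begin
      D * m                                                      ≡⟨ eliminate-n m n ⟩
      d * lin z₁ a b m n - b * lin z₂ c d m n + (b * z₂ - d * z₁)
        ≈⟨ +-congʳ (b * z₂ - d * z₁) (+-cong (*-congˡ d e₁) (neg-cong (*-congˡ b e₂))) ⟩
      d * lin z₁ a b m′ n′ - b * lin z₂ c d m′ n′ + (b * z₂ - d * z₁) ≡⟨ eliminate-n m′ n′ ⟨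
      D * m′                                                     ∎) ,
    cancel {D} cop (begin
      D * n                                                      ≡⟨ eliminate-m m n ⟩
      a * lin z₂ c d m n - c * lin z₁ a b m n + (c * z₁ - a * z₂)
        ≈⟨ +-congʳ (c * z₁ - a * z₂) (+-cong (*-congˡ a e₂) (neg-cong (*-congˡ c e₁))) ⟩
      a * lin z₂ c d m′ n′ - c * lin z₁ a b m′ n′ + (c * z₁ - a * z₂) ≡⟨ eliminate-m m′ n′ ⟨
      D * n′                                                     ∎)
    where
    D : ℤ
    D = a * d - b * c
    eliminate-n-∀ : ∀ a b c d z₁ z₂ m n → (a * d - b * c) * m
      ≡ d * (z₁ + a * m + b * n) - b * (z₂ + c * m + d * n) + (b * z₂ - d * z₁)
    eliminate-n-∀ = solve-∀
    eliminate-m-∀ : ∀ a b c d z₁ z₂ m n → (a * d - b * c) * n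
      ≡ a * (z₂ + c * m + d * n) - c * (z₁ + a * m + b * n) + (c * z₁ - a * z₂)
    eliminate-m-∀ = solve-∀
    eliminate-n : ∀ m n → D * m ≡ d * lin z₁ a b m n - b * lin z₂ c d m n + (b * z₂ - d * z₁)
    eliminate-n = eliminate-n-∀ a b c d z₁ z₂
    eliminate-m : ∀ m n → D * n ≡ a * lin z₂ c d m n - c * lin z₁ a b m n + (c * z₁ - a * z₂)
    eliminate-m = eliminate-m-∀ a b c d z₁ z₂

  affine-sum : ∀ (f : ℕ → ℕ) α β → (∀ i → + f i ≋ α + β * + i)
    → ∀ n → + sumℕ n f ≋ + n * α + β * + sumℕ n id
  affine-sum f α β f≋ zero = ≋-reflexive (vanish α β)
    where
    vanish : ∀ α β → + 0 ≡ + 0 * α + β * + 0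
    vanish = solve-∀
  affine-sum f α β f≋ (suc n) = begin
    + sumℕ (suc n) f                    ≡⟨ cong +_ (sumℕ-snoc n f) ⟩
    + (sumℕ n f +ℕ f n)                 ≡⟨ ℤP.pos-+ (sumℕ n f) (f n) ⟩
    + sumℕ n f + + f n                  ≈⟨ +-cong (affine-sum f α β f≋ n) (f≋ n) ⟩
    + n * α + β * + T + (α + β * + n)   ≡⟨ regroup (+ n) α β (+ T) ⟩
    (+ 1 + + n) * α + β * (+ T + + n)
      ≡⟨ cong₂ (λ s t → s * α + β * t) (ℤP.pos-+ 1 n) (ℤP.pos-+ T n) ⟨
    + suc n * α + β * + (T +ℕ n)        ≡⟨ cong (λ t → + suc n * α + β * + t) (sumℕ-snoc n id) ⟨
    + suc n * α + β * + sumℕ (suc n) id ∎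
    where
    T : ℕ
    T = sumℕ n id
    regroup : ∀ n α β T → n * α + β * T + (α + β * n) ≡ (+ 1 + n) * α + β * (T + n)
    regroup = solve-∀

  odd-period-sum : ¬ (2 ∣ N) → ∀ (f : ℕ → ℕ) α β → (∀ i → + f i ≋ α + β * + i) → + sumℕ N f ≋ + 0
  odd-period-sum ¬2∣N f α β f≋ with odd-sum-multiple N ¬2∣N
  ... | k , ΣN≡kN = begin
    + sumℕ N f                    ≈⟨ affine-sum f α β f≋ N ⟩
    + N * α + β * + sumℕ N id     ≡⟨ cong (λ t → + N * α + β * + t) ΣN≡kN ⟩
    + N * α + β * + (k *ℕ N)      ≡⟨ cong (λ t → + N * α + β * t) (ℤP.pos-* k N) ⟩
    + N * α + β * (+ k * + N)     ≡⟨ regroup (+ N) α β (+ k) ⟩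
    α * + N + β * + k * + N       ≈⟨ +-cong (multiple≋0 α) (multiple≋0 (β * + k)) ⟩
    + 0                           ∎
    where
    regroup : ∀ n α β k → n * α + β * (k * n) ≡ α * n + β * k * n
    regroup = solve-∀

module Cells (N : ℕ) .{{_ : NonZero N}} where
  open Congruence N

  cell-/ : ∀ {m} n → m < N → (n *ℕ N +ℕ m) / N ≡ n
  cell-/ {m} n m<N = begin
    (n *ℕ N +ℕ m) / N      ≡⟨ ℕD.+-distrib-/-∣ˡ m (n∣m*n n) ⟩
    n *ℕ N / N +ℕ m / N    ≡⟨ cong₂ _+ℕ_ (ℕD.m*n/n≡m n N) (ℕD.m<n⇒m/n≡0 m<N) ⟩
    n +ℕ 0                 ≡⟨ ℕP.+-identityʳ n ⟩
    n                      ∎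
    where open ≡-Reasoning

  cell-≋ : ∀ m n → + (n *ℕ N +ℕ m) ≋ + m
  cell-≋ m n = ℕ-≋ n (ℕP.+-comm (n *ℕ N) m)

  cell-< : ∀ {m n} → m < N → n < N → n *ℕ N +ℕ m < N *ℕ N
  cell-< {m} {n} m<N n<N = begin-strict
    n *ℕ N +ℕ m   <⟨ ℕP.+-monoʳ-< (n *ℕ N) m<N ⟩
    n *ℕ N +ℕ N   ≡⟨ ℕP.+-comm (n *ℕ N) N ⟩
    suc n *ℕ N    ≤⟨ ℕP.*-monoˡ-≤ N n<N ⟩
    N *ℕ N        ∎
    where open ℕP.≤-Reasoning

  cell-decompose : ∀ j → j ≡ (j / N) *ℕ N +ℕ j % N
  cell-decompose j = trans (ℕD.m≡m%n+[m/n]*n j N) (ℕP.+-comm (j % N) (j / N *ℕ N))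

  mod-≋ : ∀ {a b} → + a ≋ + b → a mod N ≡ b mod N
  mod-≋ {a} {b} a≋b = FinP.fromℕ<-cong (a % N) (b % N) (%ℕ-cong a≋b) (ℕD.m%n<n a N) (ℕD.m%n<n b N)

  Ridx-cell : ∀ {m} n → m < N → Ridx N (n *ℕ N +ℕ m) ≡ (m mod N , n mod N)
  Ridx-cell {m} n m<N = cong₂ _,_ (mod-≋ (cell-≋ m n)) (cong (_mod N) (cell-/ n m<N))

  coord-cell : ∀ z p q {m} n → m < N → + coord N z p q (n *ℕ N +ℕ m) ≋ lin z p q (+ m) (+ n)
  coord-cell z p q {m} n m<N =
    ≋-trans (%ℕ-≋ (lin z p q (+ i) (+ (i / N))))
      (lin-cong {z} {p} {q} (cell-≋ m n) (≋-reflexive (cong +_ (cell-/ n m<N))))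
    where
    i : ℕ
    i = n *ℕ N +ℕ m

  on-line : ∀ z p q {m n x} → x < N → m < N → lin z p q (+ m) (+ n) ≋ + x → coord N z p q (n *ℕ N +ℕ m) ≡ x
  on-line z p q {m} {n} x<N m<N on =
    residue-unique (n%ℕd<d (lin z p q (+ i) (+ (i / N))) N) x<N (≋-trans (coord-cell z p q n m<N) on)
    where
    i : ℕ
    i = n *ℕ N +ℕ m

  on-line⁻ : ∀ z p q {m n x} → m < N → coord N z p q (n *ℕ N +ℕ m) ≡ x → lin z p q (+ m) (+ n) ≋ + x
  on-line⁻ z p q {n = n} m<N refl = ≋-sym (coord-cell z p q n m<N)

  latin : ∀ {a b c d} x₁ y₁ → Coprime ∣ a * d - b * c ∣ N → (x y : ℕ) → x < N → y < N
    → Σ ℕ (λ i → i < N *ℕ N × coord N x₁ a b i ≡ x × coord N y₁ c d i ≡ y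
        × ((j : ℕ) → j < N *ℕ N → coord N x₁ a b j ≡ x → coord N y₁ c d j ≡ y → j ≡ i))
  latin {a} {b} {c} {d} x₁ y₁ cop x y x<N y<N =
    n *ℕ N +ℕ m , cell-< m<N n<N ,
    on-line x₁ a b x<N m<N on-x , on-line y₁ c d y<N m<N on-y , unique
    where
    solution : Σ ℤ (λ m → Σ ℤ (λ n → lin x₁ a b m n ≋ + x × lin y₁ c d m n ≋ + y))
    solution = cramer {a} {b} {c} {d} cop x₁ y₁ (+ x) (+ y)
    m′ n′ : ℤ
    m′ = proj₁ solution
    n′ = proj₁ (proj₂ solution)
    solves-x : lin x₁ a b m′ n′ ≋ + x
    solves-x = proj₁ (proj₂ (proj₂ solution))
    solves-y : lin y₁ c d m′ n′ ≋ + y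
    solves-y = proj₂ (proj₂ (proj₂ solution))
    m n : ℕ
    m = m′ %ℕ N
    n = n′ %ℕ N
    m<N : m < N
    m<N = n%ℕd<d m′ N
    n<N : n < N
    n<N = n%ℕd<d n′ N
    on-x : lin x₁ a b (+ m) (+ n) ≋ + x
    on-x = ≋-trans (lin-cong {x₁} {a} {b} (%ℕ-≋ m′) (%ℕ-≋ n′)) solves-x
    on-y : lin y₁ c d (+ m) (+ n) ≋ + y
    on-y = ≋-trans (lin-cong {y₁} {c} {d} (%ℕ-≋ m′) (%ℕ-≋ n′)) solves-y
    unique : (j : ℕ) → j < N *ℕ N → coord N x₁ a b j ≡ x → coord N y₁ c d j ≡ y → j ≡ n *ℕ N +ℕ m
    unique j j<NN j-on-x j-on-y =
      trans (cell-decompose j) (cong₂ (λ s t → t *ℕ N +ℕ s)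
        (residue-unique j%N<N m<N (proj₁ same)) (residue-unique j/N<N n<N (proj₂ same)))
      where
      j%N<N : j % N < N
      j%N<N = ℕD.m%n<n j N
      j/N<N : j / N < N
      j/N<N = ℕD.m<n*o⇒m/o<n j<NN
      at-cell : ∀ z p q {w} → coord N z p q j ≡ w → coord N z p q (j / N *ℕ N +ℕ j % N) ≡ w
      at-cell z p q {w} = subst (λ t → coord N z p q t ≡ w) (cell-decompose j)
      same : + (j % N) ≋ + m × + (j / N) ≋ + n
      same = cramer-unique {a} {b} {c} {d} {x₁} {y₁} cop
        (≋-trans (on-line⁻ x₁ a b j%N<N (at-cell x₁ a b j-on-x)) (≋-sym on-x))
        (≋-trans (on-line⁻ y₁ c d j%N<N (at-cell y₁ c d j-on-y)) (≋-sym on-y))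

-- The line of the grid where the coordinate z + p·m + q·n equals x, for a unit p:
-- each block n contains exactly one of its cells, at position m₀ n, and m₀ is affine in n.
module Line (N : ℕ) .{{_ : NonZero N}} (z p q : ℤ) (cop : Coprime ∣ p ∣ N) (x : ℕ) where
  open Congruence N
  open import Relation.Binary.Reasoning.Setoid ≋-setoid

  u : ℤ
  u = proj₁ (inverse p cop)

  target : ℕ → ℤ
  target n = + x - z - q * + n

  m₀ : ℕ → ℕ
  m₀ n = (u * target n) %ℕ N

  m₀<N : ∀ n → m₀ n < N
  m₀<N n = n%ℕd<d (u * target n) N

  m₀-on-line : ∀ n → lin z p q (+ m₀ n) (+ n) ≋ + x
  m₀-on-line n = begin
    lin z p q (+ m₀ n) (+ n)               ≈⟨ lin-cong {z} {p} {q} (%ℕ-≋ (u * target n)) ≋-refl ⟩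
    lin z p q (u * target n) (+ n)         ≡⟨ reorder z p q u (target n) (+ n) ⟩
    z + q * + n + u * p * target n         ≈⟨ +-congˡ (z + q * + n) (*-congʳ (target n) (proj₂ (inverse p cop))) ⟩
    z + q * + n + + 1 * target n           ≡⟨ solved z q (+ x) (+ n) ⟩
    + x                                    ∎
    where
    reorder : ∀ z p q u t n → z + p * (u * t) + q * n ≡ z + q * n + u * p * t
    reorder = solve-∀
    solved : ∀ z q x n → z + q * n + + 1 * (x - z - q * n) ≡ x
    solved = solve-∀

  m₀-unique : ∀ {m n} → m < N → lin z p q (+ m) (+ n) ≋ + x → m ≡ m₀ n
  m₀-unique {m} {n} m<N on = residue-unique m<N (m₀<N n)
    (lin-injective {z} {p} {q} cop (≋-trans on (≋-sym (m₀-on-line n))))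

  m₀-affine : ∀ n → + m₀ n ≋ u * (+ x - z) + - (u * q) * + n
  m₀-affine n = ≋-trans (%ℕ-≋ (u * target n)) (≋-reflexive (distribute u (+ x) z q (+ n)))
    where
    distribute : ∀ u x z q n → u * (x - z - q * n) ≡ u * (x - z) + - (u * q) * n
    distribute = solve-∀

module LineSums {c ℓ} (G : AbelianGroup c ℓ) (N : ℕ) .{{_ : NonZero N}}
  (ψ : Fin N × Fin N → AbelianGroup.Carrier G) (iso : IsTorsionIso G N ψ) where
  open AbelianGroup G
    using (_≈_; _∙_; ε; ∙-congˡ; identityˡ; setoid; monoid; group)
    renaming (Carrier to A; refl to ≈-refl; sym to ≈-sym; trans to ≈-trans; reflexive to ≈-reflexive)
  open IsTorsionIso iso using (hom)
  open IndexedSum monoid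
  open Congruence N using (_≋_; ≋-reflexive; odd-period-sum)
  open Cells N using (mod-≋; Ridx-cell; on-line; on-line⁻)
  open import Algebra.Properties.Group group using (identityˡ-unique)
  open import Relation.Binary.Reasoning.Setoid setoid

  addMod-mod : ∀ a b → addMod N (a mod N) (b mod N) ≡ (a +ℕ b) mod N
  addMod-mod a b = trans
    (cong₂ (λ s t → (s +ℕ t) mod N) (FinP.toℕ-fromℕ< (ℕD.m%n<n a N)) (FinP.toℕ-fromℕ< (ℕD.m%n<n b N)))
    (FinP.fromℕ<-cong _ _ (sym (ℕD.%-distribˡ-+ a b N)) (ℕD.m%n<n _ N) (ℕD.m%n<n _ N))

  ψ-zero : ψ (0 mod N , 0 mod N) ≈ ε
  ψ-zero = identityˡ-unique (ψ zero₂) (ψ zero₂)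
    (≈-trans (≈-sym (hom zero₂ zero₂)) (≈-reflexive (cong ψ (cong₂ _,_ (addMod-mod 0 0) (addMod-mod 0 0)))))
    where
    zero₂ : Fin N × Fin N
    zero₂ = (0 mod N , 0 mod N)

  ψ-sum : ∀ n (f g : ℕ → ℕ)
    → sumTo n (λ i → ψ (f i mod N , g i mod N)) ≈ ψ (sumℕ n f mod N , sumℕ n g mod N)
  ψ-sum zero    f g = ≈-sym ψ-zero
  ψ-sum (suc n) f g = begin
    ψ (f 0 mod N , g 0 mod N) ∙ sumTo n (λ i → ψ (f (suc i) mod N , g (suc i) mod N))
      ≈⟨ ∙-congˡ (ψ-sum n (f ∘ suc) (g ∘ suc)) ⟩
    ψ (f 0 mod N , g 0 mod N) ∙ ψ (sumℕ n (f ∘ suc) mod N , sumℕ n (g ∘ suc) mod N)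
      ≈⟨ hom _ _ ⟨
    ψ (addPair N (f 0 mod N , g 0 mod N) (sumℕ n (f ∘ suc) mod N , sumℕ n (g ∘ suc) mod N))
      ≡⟨ cong ψ (cong₂ _,_ (addMod-mod (f 0) _) (addMod-mod (g 0) _)) ⟩
    ψ (sumℕ (suc n) f mod N , sumℕ (suc n) g mod N) ∎

  keep : {Q : Set} → Dec Q → A → A
  keep (yes _) a = a
  keep (no _)  _ = ε

  keep-yes : ∀ {Q : Set} (Q? : Dec Q) {a} → Q → keep Q? a ≡ a
  keep-yes (yes _) _ = refl
  keep-yes (no ¬q) q = contradiction q ¬q

  keep-no : ∀ {Q : Set} (Q? : Dec Q) {a} → ¬ Q → keep Q? a ≡ ε
  keep-no (yes q) ¬q = contradiction q ¬q
  keep-no (no _)  _  = refl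

  sumG-filter : ∀ {P : Pred ℕ 0ℓ} (P? : Decidable P) (F : ℕ → A) xs
    → sumG G (map F (filter P? xs)) ≈ sumG G (map (λ i → keep (P? i) (F i)) xs)
  sumG-filter P? F []       = ≈-refl
  sumG-filter P? F (i ∷ is) with P? i
  ... | yes _ = ∙-congˡ (sumG-filter P? F is)
  ... | no _  = ≈-trans (sumG-filter P? F is) (≈-sym (identityˡ _))

  sumG-applyUpTo : ∀ (F : ℕ → A) f n → sumG G (map F (applyUpTo f n)) ≡ sumTo n (F ∘ f)
  sumG-applyUpTo F f zero    = refl
  sumG-applyUpTo F f (suc n) = cong (F (f 0) ∙_) (sumG-applyUpTo F (f ∘ suc) n)

  line-sum : ¬ (2 ∣ N) → (z p q : ℤ) → Coprime ∣ p ∣ N → (x : ℕ) → x < N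
    → sumG G (map (λ i → ψ (Ridx N i)) (cellsWith N z p q x)) ≈ ε
  line-sum ¬2∣N z p q cop x x<N = begin
    sumG G (map F (cellsWith N z p q x))              ≈⟨ sumG-filter (λ i → coord N z p q i ≟ x) F (upTo (N *ℕ N)) ⟩
    sumG G (map h (upTo (N *ℕ N)))                    ≡⟨ sumG-applyUpTo h id (N *ℕ N) ⟩
    sumTo (N *ℕ N) h                                  ≈⟨ sumTo-blocks N N h ⟩
    sumTo N (λ n → sumTo N (λ m → h (n *ℕ N +ℕ m)))   ≈⟨ sumTo-cong N block ⟩
    sumTo N (λ n → ψ (m₀ n mod N , n mod N))          ≈⟨ ψ-sum N m₀ id ⟩
    ψ (sumℕ N m₀ mod N , sumℕ N id mod N)             ≡⟨ cong ψ (cong₂ _,_ (mod-≋ Σm₀≋0) (mod-≋ Σn≋0)) ⟩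
    ψ (0 mod N , 0 mod N)                             ≈⟨ ψ-zero ⟩
    ε                                                 ∎
    where
    open Line N z p q cop x
    F : ℕ → A
    F i = ψ (Ridx N i)
    h : ℕ → A
    h i = keep (coord N z p q i ≟ x) (F i)
    Σm₀≋0 : + sumℕ N m₀ ≋ + 0
    Σm₀≋0 = odd-period-sum ¬2∣N m₀ (u * (+ x - z)) (- (u * q)) m₀-affine
    as-affine : ∀ i → i ≡ + 0 + + 1 * i
    as-affine = solve-∀
    Σn≋0 : + sumℕ N id ≋ + 0
    Σn≋0 = odd-period-sum ¬2∣N id (+ 0) (+ 1) (λ i → ≋-reflexive (as-affine (+ i)))
    -- within block n only the cell (m₀ n, n) lies on the line
    block : ∀ n → n < N → sumTo N (λ m → h (n *ℕ N +ℕ m)) ≈ ψ (m₀ n mod N , n mod N)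
    block n n<N = ≈-trans (sumTo-single N (λ m → h (n *ℕ N +ℕ m)) (m₀ n) (m₀<N n) off-line) (begin
      h (n *ℕ N +ℕ m₀ n)              ≡⟨ keep-yes (_ ≟ x) (on-line z p q x<N (m₀<N n) (m₀-on-line n)) ⟩
      ψ (Ridx N (n *ℕ N +ℕ m₀ n))     ≡⟨ cong ψ (Ridx-cell n (m₀<N n)) ⟩
      ψ (m₀ n mod N , n mod N)        ∎)
      where
      off-line : ∀ m → m < N → m ≢ m₀ n → h (n *ℕ N +ℕ m) ≈ ε
      off-line m m<N m≢m₀ = ≈-reflexive (keep-no (_ ≟ x) (λ on → m≢m₀ (m₀-unique m<N (on-line⁻ z p q m<N on))))

mainTheorem4 : {c ℓ : Level} (G : AbelianGroup c ℓ) (N : ℕ) .{{_ : NonZero N}}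
    → ¬ (2 ∣ N)
    → (ψ : Fin N × Fin N → AbelianGroup.Carrier G)
    → IsTorsionIso G N ψ
    → (a b c d x₁ y₁ : ℤ)
    → Coprime ∣ a ∣ N → Coprime ∣ b ∣ N → Coprime ∣ c ∣ N → Coprime ∣ d ∣ N
    → Coprime ∣ a * d - b * c ∣ N
    → ((x y : ℕ) → x < N → y < N
    → Σ ℕ (λ i → i < N *ℕ N × coord N x₁ a b i ≡ x × coord N y₁ c d i ≡ y
    × ((j : ℕ) → j < N *ℕ N → coord N x₁ a b j ≡ x → coord N y₁ c d j ≡ y → j ≡ i)))
    × ((x : ℕ) → x < N
    → AbelianGroup._≈_ G (sumG G (map (λ i → ψ (Ridx N i)) (cellsWith N x₁ a b x))) (AbelianGroup.ε G))
    × ((y : ℕ) → y < N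
    → AbelianGroup._≈_ G (sumG G (map (λ i → ψ (Ridx N i)) (cellsWith N y₁ c d y))) (AbelianGroup.ε G))
mainTheorem4 G N {{_}} ¬2∣N ψ iso a b c d x₁ y₁ a-unit _ c-unit _ det-unit =
  Cells.latin N {a} {b} {c} {d} x₁ y₁ det-unit ,
  LineSums.line-sum G N ψ iso ¬2∣N x₁ a b a-unit ,
  LineSums.line-sum G N ψ iso ¬2∣N y₁ c d c-unit
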